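{- Let $G$ and $H$ be two connected graphs, let $x\in V(G)$ and $v\in V(H)$, let $B$ be a strong metric basis of $G\circ_v H$, let $B_x=B\cap(\{x\}\times V(H))$, and let $M(v)$ be the set of vertices of $H$ which are maximally distant from $v$. Then: (i) $|B_x|\ge \dim_s(H)-1$; (ii) if $B_x$ contains $\{x\}\times M(v)$, then $|B_x|\ge\dim_s(H)$; (iii) if $v$ does not belong to any strong metric basis of $H$, then $|B_x|\ge\dim_s(H)$.
   Context: All graphs are finite and simple; $d$ denotes shortest-path distance. A vertex $w$ strongly resolves $u,y$ if $d(w,u)=d(w,y)+d(y,u)$ or $d(w,y)=d(w,u)+d(u,y)$. A strong metric generator of a connected graph $X$ is a set of vertices $S$ such that every pair of vertices is strongly resolved by some vertex of $S$; $\dim_s(X)$ is the minimum cardinality of such a set, and a strong metric basis is a strong metric generator of cardinality $\dim_s(X)$. A vertex $u$ is maximally distant from $w$ if for every neighbour $z$ of $u$, $d(w,z)\le d(u,w)$. Rooted product: for a graph $G$ with $V(G)=\{u_1,\dots,u_n\}$ and a graph $H$ with root $v$, $G\circ_v H$ has vertex set $V(G)\times V(H)$ and edge set $\bigcup_{i=1}^n\{(u_i,b)(u_i,y): by\in E(H)\}\cup\{(u_i,v)(u_j,v): u_iu_j\in E(G)\}$. -}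

module Defs where

open import Data.Nat using (ℕ; zero; suc; _+_; _≤_)
open import Data.Fin using (Fin)
open import Data.Fin.Properties using (_≟_)
open import Data.Product using (Σ; ∃; _×_; _,_; proj₁)
open import Data.Sum using (_⊎_; inj₁; inj₂)
open import Data.Empty using (⊥)
open import Data.List using (List; length; filter)
open import Data.List.Membership.Propositional using (_∈_; _∉_)
open import Data.List.Relation.Unary.Unique.Propositional using (Unique)
open import Relation.Nullary using (¬_)
open import Relation.Binary.PropositionalEquality using (_≡_; _≢_; refl)

record Graph (V : Set) : Set₁ where
  field
    Adj   : V → V → Set
    adj-sym : ∀ {u w} → Adj u w → Adj w u
    adj-irr : ∀ {u} → ¬ Adj u u
open Graph public

data Walk {V : Set} (X : Graph V) : V → V → ℕ → Set where
  here : ∀ {u} → Walk X u u 0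
  step : ∀ {u z w k} → Adj X u z → Walk X z w k → Walk X u w (suc k)

Connected : {V : Set} → Graph V → Set
Connected X = ∀ u w → ∃ λ k → Walk X u w k

IsDist : {V : Set} → Graph V → V → V → ℕ → Set
IsDist X u w k = Walk X u w k × (∀ m → Walk X u w m → k ≤ m)

StronglyResolves : {V : Set} → Graph V → V → V → V → Set
StronglyResolves X w u y =
  (Σ ℕ λ a → Σ ℕ λ b → Σ ℕ λ c →
     IsDist X w u a × IsDist X w y b × IsDist X y u c × a ≡ b + c)
  ⊎
  (Σ ℕ λ a → Σ ℕ λ b → Σ ℕ λ c →
     IsDist X w y a × IsDist X w u b × IsDist X u y c × a ≡ b + c)

-- Vertex sets are duplicate-free lists; cardinality is length.
IsStrongMetricGenerator : {V : Set} → Graph V → List V → Set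
IsStrongMetricGenerator X S =
  Unique S × (∀ u y → u ≢ y → Σ _ λ w → w ∈ S × StronglyResolves X w u y)

IsStrongMetricBasis : {V : Set} → Graph V → List V → Set
IsStrongMetricBasis X S =
  IsStrongMetricGenerator X S ×
  (∀ T → IsStrongMetricGenerator X T → length S ≤ length T)

IsStrongMetricDim : {V : Set} → Graph V → ℕ → Set
IsStrongMetricDim X k = Σ _ λ S → IsStrongMetricBasis X S × length S ≡ k

MaximallyDistant : {V : Set} → Graph V → V → V → Set
MaximallyDistant X w u =
  ∀ z → Adj X u z → ∀ a b → IsDist X w z a → IsDist X u w b → a ≤ b

private
  RAdj : ∀ {n m} → Graph (Fin n) → Graph (Fin m) → Fin m →
         Fin n × Fin m → Fin n × Fin m → Set
  RAdj G H v (a , b) (c , y) =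
    (a ≡ c × Adj H b y) ⊎ (b ≡ v × y ≡ v × Adj G a c)

rootedProduct : ∀ {n m} → Graph (Fin n) → Graph (Fin m) → Fin m →
                Graph (Fin n × Fin m)
rootedProduct G H v = record
  { Adj   = RAdj G H v
  ; adj-sym = λ { (inj₁ (refl , e)) → inj₁ (refl , adj-sym H e)
              ; (inj₂ (p , q , e)) → inj₂ (q , p , adj-sym G e) }
  ; adj-irr = λ { (inj₁ (_ , e)) → adj-irr H e
              ; (inj₂ (_ , _ , e)) → adj-irr G e } }

fiber : ∀ {n m} → Fin n → List (Fin n × Fin m) → List (Fin n × Fin m)
fiber x B = filter (λ p → proj₁ p ≟ x) B

module Submission where

-- Let P = G ∘_v H, fix a fibre {x} × V(H) and let S ⊆ V(H) be the list of
-- second coordinates of B_x = B ∩ ({x} × V(H)) for a strong metric basis B of P.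
--
--  * Every fibre is an isometric copy of H, so a resolver inside the fibre
--    resolves the corresponding pair of H (fibre-resolves).
--  * Every shortest path entering the fibre from outside passes through the
--    root (x , v), so a resolver outside the fibre can be replaced by v
--    (outside-resolves).  Hence every pair of H is resolved by S or by v.
--  * Following ever farther neighbours away from v ends, in a graph with
--    bounded distances, at a vertex maximally distant from v, and that vertex
--    strongly resolves every pair that v does (maximally-distant-resolves).
--
-- Therefore S ∪ {v} is a strong metric generator of H, which gives (i), and
-- gives (iii) because S ∪ {v} cannot be a basis when v lies in no basis; if S
-- contains M(v) then S itself is a generator, which gives (ii).  That last step
-- is classical (an abstract adjacency relation need not be decidable), which
-- is harmless since its conclusion k ≤ |B_x| is decidable.

open import Defs
open import Data.Nat using (ℕ; zero; suc; _+_; _≤_; _<_; z≤n; s≤s; _≤?_)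
open import Data.Nat.Properties
  using (≤-antisym; ≤-trans; +-suc; +-assoc; +-comm; +-identityʳ; +-cancelˡ-≡;
         +-cancelˡ-≤; +-cancelʳ-≤; m≤n⇒m≤1+n; m≤n+m; ≰⇒>; <⇒≱; m≤n⇒m<n∨m≡n; ≤-pred; ≤-refl; n≤1+n)
open import Data.Fin using (Fin)
import Data.Fin as F
open import Data.Fin.Properties using (_≟_)
open import Data.Product using (Σ; _×_; _,_; proj₁; proj₂)
open import Data.Sum using (_⊎_; inj₁; inj₂; [_,_])
open import Data.Empty using (⊥-elim)
open import Data.List using (List; []; _∷_; length; map; allFin)
open import Data.List.Properties using (length-map)
open import Data.List.Extrema.Nat using (argmax; f[xs]≤f[argmax])
open import Data.List.Membership.Propositional using (_∈_; _∉_)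
open import Data.List.Membership.Propositional.Properties using (∈-filter⁺; ∈-map⁺; ∈-allFin)
open import Data.List.Membership.DecPropositional using (_∈?_)
open import Data.List.Relation.Unary.All as All using (All)
import Data.List.Relation.Unary.All.Properties as All
open import Data.List.Relation.Unary.Any using (here; there)
open import Data.List.Relation.Unary.AllPairs using ([]; _∷_)
open import Data.List.Relation.Unary.Unique.Propositional using (Unique)
import Data.List.Relation.Unary.Unique.Propositional.Properties as Unique
open import Relation.Nullary using (¬_; Dec; yes; no)
open import Relation.Nullary.Decidable using (decidable-stable; ¬¬-excluded-middle)
open import Relation.Binary using (DecidableEquality)
open import Relation.Binary.PropositionalEquality
  using (_≡_; _≢_; refl; sym; trans; cong; cong₂; subst; module ≡-Reasoning)

module _ {V : Set} {X : Graph V} where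

  _++ʷ_ : ∀ {a b c k l} → Walk X a b k → Walk X b c l → Walk X a c (k + l)
  here     ++ʷ q = q
  step e p ++ʷ q = step e (p ++ʷ q)

  reverse-onto : ∀ {a b c k j} → Walk X a b k → Walk X a c j → Walk X b c (k + j)
  reverse-onto here acc = acc
  reverse-onto {k = suc k} {j} (step e p) acc =
    subst (Walk X _ _) (+-suc k j) (reverse-onto p (step (adj-sym X e) acc))

  reverse : ∀ {a b k} → Walk X a b k → Walk X b a k
  reverse {k = k} p = subst (Walk X _ _) (+-identityʳ k) (reverse-onto p here)

  dist-sym : ∀ {a b k} → IsDist X a b k → IsDist X b a k
  dist-sym (p , shortest) = reverse p , λ _ q → shortest _ (reverse q)

  dist-unique : ∀ {a b k l} → IsDist X a b k → IsDist X a b l → k ≡ l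
  dist-unique (p , shortest-p) (q , shortest-q) = ≤-antisym (shortest-p _ q) (shortest-q _ p)

  geodesic-prefix : ∀ {s r t a a₁ a₂} → IsDist X s t a → Walk X s r a₁ → Walk X r t a₂ →
                    a ≡ a₁ + a₂ → IsDist X s r a₁
  geodesic-prefix {a₁ = a₁} {a₂} (_ , shortest) p q a≡ = p , λ k p′ →
    +-cancelʳ-≤ a₂ a₁ k (subst (_≤ k + a₂) a≡ (shortest _ (p′ ++ʷ q)))

  geodesic-suffix : ∀ {s r t a a₁ a₂} → IsDist X s t a → Walk X s r a₁ → Walk X r t a₂ →
                    a ≡ a₁ + a₂ → IsDist X r t a₂
  geodesic-suffix {a₁ = a₁} {a₂} (_ , shortest) p q a≡ = q , λ k q′ →
    +-cancelˡ-≤ a₁ a₂ k (subst (_≤ a₁ + k) a≡ (shortest _ (p ++ʷ q′)))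

-- p lies on a shortest w–q path: d(w,q) = d(w,p) + d(p,q).  By definition,
-- StronglyResolves X w u y unfolds to  Between X w y u ⊎ Between X w u y.
Between : {V : Set} → Graph V → V → V → V → Set
Between X w p q = Σ ℕ λ a → Σ ℕ λ b → Σ ℕ λ c →
  IsDist X w q a × IsDist X w p b × IsDist X p q c × a ≡ b + c

module RootedProduct {n m} (G : Graph (Fin n)) (H : Graph (Fin m)) (v : Fin m) where

  P : Graph (Fin n × Fin m)
  P = rootedProduct G H v

  lift : ∀ {x a b k} → Walk H a b k → Walk P (x , a) (x , b) k
  lift here       = here
  lift (step e p) = step (inj₁ (refl , e)) (lift p)

  -- Forgetting the first coordinate turns a walk of P into a walk of H that is
  -- no longer (edges of G become stays at the root).
  project : ∀ {a b c y k} → Walk P (a , b) (c , y) k → Σ ℕ λ k′ → k′ ≤ k × Walk H b y k′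
  project here = 0 , z≤n , here
  project (step {z = _ , _} (inj₁ (refl , e)) p) with project p
  ... | k′ , k′≤ , q = suc k′ , s≤s k′≤ , step e q
  project (step {z = _ , _} (inj₂ (refl , refl , _)) p) with project p
  ... | k′ , k′≤ , q = k′ , m≤n⇒m≤1+n k′≤ , q

  fibre-dist : ∀ {x a b d} → IsDist P (x , a) (x , b) d → IsDist H a b d
  fibre-dist {x} (p , shortest) with project p
  ... | k′ , k′≤ , q =
    subst (Walk H _ _) (≤-antisym k′≤ (shortest _ (lift {x} q))) q ,
    λ _ q′ → shortest _ (lift q′)

  transfer : ∀ {x w w′ u y} →
             (∀ {p q} → Between P w (x , p) (x , q) → Between H w′ p q) →
             StronglyResolves P w (x , u) (x , y) → StronglyResolves H w′ u y
  transfer f (inj₁ r) = inj₁ (f r)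
  transfer f (inj₂ r) = inj₂ (f r)

  fibre-resolves : ∀ {x h u y} → StronglyResolves P (x , h) (x , u) (x , y) → StronglyResolves H h u y
  fibre-resolves = transfer λ { (a , b , c , d₁ , d₂ , d₃ , a≡) →
    a , b , c , fibre-dist d₁ , fibre-dist d₂ , fibre-dist d₃ , a≡ }

  enter-through-root : ∀ {x x′ h u k} → x′ ≢ x → Walk P (x′ , h) (x , u) k →
    Σ ℕ λ k₁ → Σ ℕ λ k₂ →
      Walk P (x′ , h) (x , v) k₁ × Walk P (x , v) (x , u) k₂ × k ≡ k₁ + k₂
  enter-through-root x′≢x here = ⊥-elim (x′≢x refl)
  enter-through-root x′≢x (step {z = _ , _} (inj₁ (refl , e)) p) with enter-through-root x′≢x p
  ... | k₁ , k₂ , p₁ , p₂ , k≡ = suc k₁ , k₂ , step (inj₁ (refl , e)) p₁ , p₂ , cong suc k≡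
  enter-through-root {x} x′≢x (step {z = x″ , _} (inj₂ (refl , refl , e)) p) with x″ ≟ x
  ... | yes refl = 1 , _ , step (inj₂ (refl , refl , e)) here , p , refl
  ... | no x″≢x with enter-through-root x″≢x p
  ...   | k₁ , k₂ , p₁ , p₂ , k≡ = suc k₁ , k₂ , step (inj₂ (refl , refl , e)) p₁ , p₂ , cong suc k≡

  geodesic-through-root : ∀ {x x′ h u a} → x′ ≢ x → IsDist P (x′ , h) (x , u) a →
    Σ ℕ λ r → Σ ℕ λ a₂ → IsDist P (x′ , h) (x , v) r × IsDist H v u a₂ × a ≡ r + a₂
  geodesic-through-root x′≢x d with enter-through-root x′≢x (proj₁ d)
  ... | k₁ , k₂ , p₁ , p₂ , a≡ =
    k₁ , k₂ , geodesic-prefix d p₁ p₂ a≡ , fibre-dist (geodesic-suffix d p₁ p₂ a≡) , a≡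

  outside-resolves : ∀ {x x′ h u y} → x′ ≢ x →
                     StronglyResolves P (x′ , h) (x , u) (x , y) → StronglyResolves H v u y
  outside-resolves x′≢x = transfer outside-between
    where
    outside-between : ∀ {p q} → Between P _ (_ , p) (_ , q) → Between H v p q
    outside-between (a , b , c , dq , dp , dpq , a≡b+c)
      with geodesic-through-root x′≢x dq | geodesic-through-root x′≢x dp
    ... | r , a₂ , dr , dvq , a≡ | r′ , b₂ , dr′ , dvp , b≡ =
      a₂ , b₂ , c , dvq , dvp , fibre-dist dpq , +-cancelˡ-≡ r _ _ cancel
      where
      open ≡-Reasoning
      cancel : r + a₂ ≡ r + (b₂ + c)
      cancel = begin
        r + a₂             ≡⟨ sym a≡ ⟩
        a                  ≡⟨ a≡b+c ⟩
        b + c              ≡⟨ cong (_+ c) b≡ ⟩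
        (r′ + b₂) + c      ≡⟨ +-assoc r′ b₂ c ⟩
        r′ + (b₂ + c)      ≡⟨ cong (_+ (b₂ + c)) (dist-unique dr′ dr) ⟩
        r + (b₂ + c)       ∎

-- u has a neighbour strictly farther from v than u itself; this is exactly the
-- failure of u being maximally distant from v.
FartherNeighbour : {V : Set} → Graph V → V → V → Set
FartherNeighbour {V} X v u = Σ V λ z → Adj X u z ×
  Σ ℕ λ a → IsDist X v z a × Σ ℕ λ b → IsDist X u v b × b < a

module Climbing {V : Set} (X : Graph V) (v : V) (N : ℕ)
  (bounded : ∀ u d → IsDist X v u d → d ≤ N)
  (farther? : ∀ u → Dec (FartherNeighbour X v u)) where

  farther-neighbour-dist : ∀ {u d} → IsDist X v u d → FartherNeighbour X v u →
                           Σ V λ z → Adj X u z × IsDist X v z (suc d)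
  farther-neighbour-dist {d = d} du (z , u~z , a , dz , b , du′ , b<a) =
    z , u~z , subst (IsDist X v z) (≤-antisym a≤1+d 1+d≤a) dz
    where
    a≤1+d : a ≤ suc d
    a≤1+d = subst (a ≤_) (+-comm d 1) (proj₂ dz _ (proj₁ du ++ʷ step u~z here))
    1+d≤a : suc d ≤ a
    1+d≤a = subst (λ b → suc b ≤ a) (dist-unique (dist-sym du′) du) b<a

  maximal-or-farther : ∀ {u d} → IsDist X v u d →
    MaximallyDistant X v u ⊎ (Σ V λ z → Adj X u z × IsDist X v z (suc d))
  maximal-or-farther {u} du with farther? u
  ... | yes far  = inj₂ (farther-neighbour-dist du far)
  ... | no none = inj₁ maximal
    where
    maximal : MaximallyDistant X v u
    maximal z u~z a b dz du′ with a ≤? b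
    ... | yes a≤b = a≤b
    ... | no a≰b  = ⊥-elim (none (z , u~z , a , dz , b , du′ , ≰⇒> a≰b))

  -- Follow farther neighbours from u until a maximally distant vertex is
  -- reached; the walk taken stays on a shortest path from v.  The fuel t
  -- covers the remaining room N − d.
  climb : ∀ t {u d} → IsDist X v u d → N ≤ d + t →
    Σ V λ u′ → Σ ℕ λ e → MaximallyDistant X v u′ × IsDist X v u′ (d + e) × Walk X u u′ e
  climb t {u} {d} du fuel = ascend t (maximal-or-farther du) fuel
    where
    ascend : ∀ t → MaximallyDistant X v u ⊎ (Σ V λ z → Adj X u z × IsDist X v z (suc d)) →
      N ≤ d + t →
      Σ V λ u′ → Σ ℕ λ e → MaximallyDistant X v u′ × IsDist X v u′ (d + e) × Walk X u u′ e
    ascend _ (inj₁ maximal) _ =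
      u , 0 , maximal , subst (IsDist X v u) (sym (+-identityʳ d)) du , here
    ascend zero (inj₂ (z , _ , dz)) fuel =
      ⊥-elim (<⇒≱ (bounded z (suc d) dz) (subst (N ≤_) (+-identityʳ d) fuel))
    ascend (suc t) (inj₂ (z , u~z , dz)) fuel with climb t dz (subst (N ≤_) (+-suc d t) fuel)
    ... | u′ , e , maximal , du′ , p =
      u′ , suc e , maximal , subst (IsDist X v u′) (sym (+-suc d e)) du′ , step u~z p

  -- If y lies on a shortest v–u path, then u lies on a shortest w–y path for
  -- the maximally distant vertex w reached by climbing beyond u.
  beyond : ∀ {u y} → Between X v y u → Σ V λ w → MaximallyDistant X v w × Between X w u y
  beyond {u} {y} (_ , b , c , du , dy , dyu , refl) with climb N du (m≤n+m N (b + c))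
  ... | w , e , maximal , dw , p =
    w , maximal , c + e , e , c , dist-sym dyw , dist-sym duw , dist-sym dyu , +-comm c e
    where
    duw : IsDist X u w e
    duw = geodesic-suffix dw (proj₁ du) p refl
    dyw : IsDist X y w (c + e)
    dyw = geodesic-suffix dw (proj₁ dy) (proj₁ dyu ++ʷ p) (+-assoc b c e)

  maximally-distant-resolves : ∀ {u y} → StronglyResolves X v u y →
    Σ V λ w → MaximallyDistant X v w × StronglyResolves X w u y
  maximally-distant-resolves (inj₁ r) with beyond r
  ... | w , maximal , r′ = w , maximal , inj₂ r′
  maximally-distant-resolves (inj₂ r) with beyond r
  ... | w , maximal , r′ = w , maximal , inj₁ r′

¬¬-shift : ∀ n {Q : Fin n → Set} → (∀ i → ¬ ¬ Q i) → ¬ ¬ (∀ i → Q i)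
¬¬-shift zero    _   none = none λ ()
¬¬-shift (suc n) ¬¬Q none = ¬¬Q F.zero λ q₀ → ¬¬-shift n (λ i → ¬¬Q (F.suc i)) λ qs →
  none λ { F.zero → q₀ ; (F.suc i) → qs i }

distances-bounded : ∀ {m} (H : Graph (Fin m)) → Connected H → (v : Fin m) →
                    Σ ℕ λ N → ∀ u d → IsDist H v u d → d ≤ N
distances-bounded {m} H connected v =
  walk-length (argmax walk-length v (allFin m)) ,
  λ u d (_ , shortest) → ≤-trans (shortest _ (proj₂ (connected v u)))
    (All.lookup (f[xs]≤f[argmax] {f = walk-length} v (allFin m)) (∈-allFin u))
  where
  walk-length : Fin m → ℕ
  walk-length u = proj₁ (connected v u)

¬¬-maximally-distant-resolves : ∀ {m} (H : Graph (Fin m)) → Connected H → (v : Fin m) →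
  ¬ ¬ (∀ u y → StronglyResolves H v u y →
         Σ (Fin m) λ w → MaximallyDistant H v w × StronglyResolves H w u y)
¬¬-maximally-distant-resolves {m} H connected v conclusion =
  ¬¬-shift m (λ _ → ¬¬-excluded-middle) λ farther? →
    conclusion λ _ _ → Climbing.maximally-distant-resolves H v N bounded farther?
  where
  N : ℕ
  N = proj₁ (distances-bounded H connected v)
  bounded : ∀ u d → IsDist H v u d → d ≤ N
  bounded = proj₂ (distances-bounded H connected v)

dimension-≤ : ∀ {V : Set} {X : Graph V} {k T} →
              IsStrongMetricDim X k → IsStrongMetricGenerator X T → k ≤ length T
dimension-≤ (_ , (_ , minimal) , refl) generator = minimal _ generator

basis-of-dimension-size : ∀ {V : Set} {X : Graph V} {k T} → IsStrongMetricDim X k →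
  IsStrongMetricGenerator X T → length T ≡ k → IsStrongMetricBasis X T
basis-of-dimension-size dim generator refl =
  generator , λ _ generator′ → dimension-≤ dim generator′

adjoin : ∀ {A : Set} → DecidableEquality A → (a : A) (S : List A) → Unique S →
  Σ (List A) λ T → Unique T × a ∈ T × (∀ {b} → b ∈ S → b ∈ T) × length T ≤ suc (length S)
adjoin _≟ᴬ_ a S unique-S with _∈?_ _≟ᴬ_ a S
... | yes a∈S = S , unique-S , a∈S , (λ b∈S → b∈S) , n≤1+n (length S)
... | no a∉S  = a ∷ S , All.¬Any⇒All¬ S a∉S ∷ unique-S , here refl , there , ≤-refl

dimension-<-avoiding : ∀ {V : Set} {X : Graph V} {k s v T} → IsStrongMetricDim X k →
  IsStrongMetricGenerator X T → v ∈ T → length T ≤ suc s →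
  (∀ S → IsStrongMetricBasis X S → v ∉ S) → k ≤ s
dimension-<-avoiding {k = k} {s} {T = T} dim generator v∈T |T|≤1+s v∉bases
  with m≤n⇒m<n∨m≡n (≤-trans (dimension-≤ dim generator) |T|≤1+s)
... | inj₁ k<1+s = ≤-pred k<1+s
... | inj₂ k≡1+s = ⊥-elim (v∉bases T (basis-of-dimension-size dim generator |T|≡k) v∈T)
  where
  |T|≡k : length T ≡ k
  |T|≡k = ≤-antisym (subst (length T ≤_) (sym k≡1+s) |T|≤1+s) (dimension-≤ dim generator)

second-coordinates-unique : ∀ {A B : Set} {x : A} (L : List (A × B)) →
  Unique L → All (λ p → proj₁ p ≡ x) L → Unique (map proj₂ L)
second-coordinates-unique []      []          All.[] = []
second-coordinates-unique {x = x} (p ∷ L) (p∉L ∷ unique-L) (p₁≡x All.∷ L₁≡x) =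
  All.map⁺ (All.zipWith distinct (p∉L , L₁≡x)) ∷ second-coordinates-unique L unique-L L₁≡x
  where
  distinct : ∀ {q} → p ≢ q × proj₁ q ≡ x → proj₂ p ≢ proj₂ q
  distinct (p≢q , q₁≡x) p₂≡q₂ = p≢q (cong₂ _,_ (trans p₁≡x (sym q₁≡x)) p₂≡q₂)

-- The trace S of a strong metric generator B of G ∘_v H on the fibre of x,
-- read as a set of vertices of H.
module Fibre {n m} (G : Graph (Fin n)) (H : Graph (Fin m)) (v : Fin m) (x : Fin n)
  (B : List (Fin n × Fin m)) (generator-B : IsStrongMetricGenerator (rootedProduct G H v) B) where

  open RootedProduct G H v

  S : List (Fin m)
  S = map proj₂ (fiber x B)

  |S|≡|Bx| : length S ≡ length (fiber x B)
  |S|≡|Bx| = length-map proj₂ (fiber x B)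

  S-unique : Unique S
  S-unique = second-coordinates-unique (fiber x B)
    (Unique.filter⁺ (λ p → proj₁ p ≟ x) (proj₁ generator-B))
    (All.all-filter (λ p → proj₁ p ≟ x) B)

  in-S : ∀ {h} → (x , h) ∈ fiber x B → h ∈ S
  in-S = ∈-map⁺ proj₂

  resolved-by-S-or-root : ∀ u y → u ≢ y →
    (Σ (Fin m) λ w → w ∈ S × StronglyResolves H w u y) ⊎ StronglyResolves H v u y
  resolved-by-S-or-root u y u≢y with proj₂ generator-B (x , u) (x , y) (λ eq → u≢y (cong proj₂ eq))
  ... | (x′ , h) , h∈B , resolves with x′ ≟ x
  ...   | yes refl = inj₁ (h , in-S (∈-filter⁺ (λ p → proj₁ p ≟ x) h∈B refl) , fibre-resolves resolves)
  ...   | no x′≢x  = inj₂ (outside-resolves x′≢x resolves)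

  generator-above-S : ∀ T → Unique T → (∀ {h} → h ∈ S → h ∈ T) →
    (∀ {u y} → StronglyResolves H v u y → Σ (Fin m) λ w → w ∈ T × StronglyResolves H w u y) →
    IsStrongMetricGenerator H T
  generator-above-S T unique-T S⊆T root-covered = unique-T , λ u y u≢y →
    [ (λ { (w , w∈S , r) → w , S⊆T w∈S , r }) , root-covered ] (resolved-by-S-or-root u y u≢y)

  S+root : Σ (List (Fin m)) λ T →
    IsStrongMetricGenerator H T × v ∈ T × length T ≤ suc (length (fiber x B))
  S+root with adjoin _≟_ v S S-unique
  ... | T , unique-T , v∈T , S⊆T , |T|≤ =
    T , generator-above-S T unique-T S⊆T (λ r → v , v∈T , r) , v∈T ,
    subst (λ s → length T ≤ suc s) |S|≡|Bx| |T|≤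

  dimension-≤-trace : ∀ {k} → Connected H → IsStrongMetricDim H k →
    (∀ h → MaximallyDistant H v h → (x , h) ∈ fiber x B) → k ≤ length (fiber x B)
  dimension-≤-trace {k} connected dim covers = decidable-stable (k ≤? length (fiber x B)) λ k≰ →
    ¬¬-maximally-distant-resolves H connected v λ maximal-resolver →
      k≰ (subst (k ≤_) |S|≡|Bx| (dimension-≤ dim (generator-above-S S S-unique (λ h∈S → h∈S)
        λ {u} {y} r → let (w , maximal , r′) = maximal-resolver u y r in w , in-S (covers w maximal) , r′)))

lemma20 : ∀ {n m} (G : Graph (Fin n)) (H : Graph (Fin m)) →
    Connected G → Connected H →
    (x : Fin n) (v : Fin m) (B : List (Fin n × Fin m)) →
    IsStrongMetricBasis (rootedProduct G H v) B →
    (k : ℕ) → IsStrongMetricDim H k →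
    (k ≤ suc (length (fiber x B)))
    × ((∀ h → MaximallyDistant H v h → (x , h) ∈ fiber x B) → k ≤ length (fiber x B))
    × ((∀ S → IsStrongMetricBasis H S → v ∉ S) → k ≤ length (fiber x B))
lemma20 G H _ connected-H x v B (generator-B , _) k dim-H
  with Fibre.S+root G H v x B generator-B
... | T , generator-T , v∈T , |T|≤1+|Bx| =
  ≤-trans (dimension-≤ dim-H generator-T) |T|≤1+|Bx| ,
  Fibre.dimension-≤-trace G H v x B generator-B connected-H dim-H ,
  dimension-<-avoiding dim-H generator-T v∈T |T|≤1+|Bx|
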